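{- Every factor (in $\mathbb Z[x,y]$) of a generating polynomial has a single monomial of highest total degree.
   Context: The generating polynomial of a binary string $s=s_1\cdots s_n$ is $P_s(x,y)=\sum_{i=0}^n x^{a_i}y^{b_i}$, where $a_i,b_i$ are the numbers of 0's and 1's among $s_1,\dots,s_i$; a generating polynomial is one of this form for some binary string. The total degree of $x^ay^b$ is $a+b$. -}

module Defs where

open import Data.Nat using (ℕ; zero; suc; _<_) renaming (_+_ to _+ℕ_; _≟_ to _≟ℕ_)
open import Data.Integer using (ℤ; 0ℤ; 1ℤ) renaming (_+_ to _+ℤ_; _*_ to _*ℤ_)
open import Data.Bool using (Bool; true; false; if_then_else_; _∧_)
open import Data.List using (List; []; _∷_; concatMap; map)
open import Data.Product using (_×_; _,_; Σ; ∃)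
open import Data.Sum using (_⊎_)
open import Relation.Nullary using (¬_; does)
open import Relation.Binary.PropositionalEquality using (_≡_)

-- A polynomial in ℤ[x,y], represented by a finite list of terms
-- (c , a , b) standing for c·x^a·y^b (repetitions allowed; the
-- polynomial is their sum).  Two representations denote the same
-- polynomial iff all their coefficients agree (see _≈P_).
Term : Set
Term = ℤ × ℕ × ℕ

Poly : Set
Poly = List Term

coeff : Poly → ℕ → ℕ → ℤ
coeff [] a b = 0ℤ
coeff ((c , a' , b') ∷ p) a b =
  (if does (a' ≟ℕ a) ∧ does (b' ≟ℕ b) then c else 0ℤ) +ℤ coeff p a b

_≈P_ : Poly → Poly → Set
p ≈P q = ∀ a b → coeff p a b ≡ coeff q a b

_*P_ : Poly → Poly → Poly
p *P q = concatMap (λ { (c , a , b) → map (λ { (d , a' , b') → (c *ℤ d , a +ℕ a' , b +ℕ b') }) q }) p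

_∣P_ : Poly → Poly → Set
f ∣P g = Σ Poly λ h → (f *P h) ≈P g

-- Generating polynomial of a binary string; the bit false stands for the
-- letter 0 and true for the letter 1.  genAux a b s = Σ_{i=0}^{|s|} x^{a+a_i} y^{b+b_i}.
genAux : ℕ → ℕ → List Bool → Poly
genAux a b [] = (1ℤ , a , b) ∷ []
genAux a b (false ∷ s) = (1ℤ , a , b) ∷ genAux (suc a) b s
genAux a b (true ∷ s) = (1ℤ , a , b) ∷ genAux a (suc b) s

genPoly : List Bool → Poly
genPoly s = genAux 0 0 s

IsGenerating : Poly → Set
IsGenerating p = Σ (List Bool) λ s → p ≈P genPoly s

SingleTopMonomial : Poly → Set
SingleTopMonomial p =
  Σ ℕ λ a → Σ ℕ λ b → ¬ (coeff p a b ≡ 0ℤ) ×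
    (∀ c d → ¬ (coeff p c d ≡ 0ℤ) → (c +ℕ d < a +ℕ b) ⊎ ((c ≡ a) × (d ≡ b)))

-- A monomial order on ℤ[x,y] that refines the total degree makes the leading
-- monomial of a product the product of the leading monomials.  Use the two
-- graded orders that break ties by the power of x and by the power of y.  If
-- f h = g and g has a single monomial of top degree, then in both orders the
-- leading monomials of f and h multiply to that monomial.  Comparing the two
-- decompositions forces the x-leading and the y-leading monomials of f to
-- coincide, and a monomial that is largest in both tie-breaks is the only one
-- of its degree.  Generating polynomials have a single top monomial, namely
-- the one for the whole string.
module Submission where

open import Defs
open import Data.Bool using (Bool; true; false; if_then_else_; _∧_)
open import Data.Empty using (⊥; ⊥-elim)
open import Data.Integer using (ℤ; 0ℤ; 1ℤ) renaming (_+_ to _+ℤ_; _*_ to _*ℤ_)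
import Data.Integer.Properties as ℤ
open import Data.List using (List; []; _∷_; map; _++_; filter)
open import Data.List.Membership.Propositional using (_∈_)
open import Data.List.Membership.Propositional.Properties using (∈-filter⁺)
open import Data.List.Relation.Unary.All using (lookup)
open import Data.List.Relation.Unary.All.Properties using (all-filter)
open import Data.List.Relation.Unary.Any using (here; there)
open import Data.Nat using (ℕ; zero; suc; _+_; _∸_; _≤_; _<_; _≟_; _≤?_; z≤n; s≤s)
import Data.Nat.Properties as ℕ
open import Algebra.Properties.CommutativeSemigroup ℕ.+-commutativeSemigroup using (interchange)
open import Data.Product using (_×_; _,_; proj₁; proj₂; ∃; ∃-syntax)
open import Data.Product.Properties using (≡-dec; ×-≡,≡→≡; ×-≡,≡←≡)
open import Data.Product.Relation.Binary.Lex.NonStrict using (×-totalOrder)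
open import Data.Product.Relation.Binary.Pointwise.NonDependent using (≡×≡⇒≡)
open import Data.Sum using (_⊎_; inj₁; inj₂; [_,_])
import Data.Sum as Sum
open import Function using (_∘_)
open import Relation.Binary using (TotalOrder)
open import Relation.Nullary using (¬_; Dec; does; yes; no; ¬?)
open import Relation.Nullary.Decidable using (decidable-stable; dec-true; dec-false)
open import Relation.Binary.PropositionalEquality hiding ([_])

Exp : Set
Exp = ℕ × ℕ

deg : Exp → ℕ
deg (a , b) = a + b

_⊕_ : Exp → Exp → Exp
(a , b) ⊕ (a' , b') = a + a' , b + b'

deg-⊕ : ∀ e e' → deg (e ⊕ e') ≡ deg e + deg e'
deg-⊕ (a , b) (a' , b') = interchange a a' b b'

⊕-cancelˡ : ∀ m {e e'} → m ⊕ e ≡ m ⊕ e' → e ≡ e'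
⊕-cancelˡ (a , b) eq =
  ×-≡,≡→≡ (ℕ.+-cancelˡ-≡ a _ _ (cong proj₁ eq) , ℕ.+-cancelˡ-≡ b _ _ (cong proj₂ eq))

_≟ₑ_ : (e e' : Exp) → Dec (e ≡ e')
_≟ₑ_ = ≡-dec _≟_ _≟_

_≤ₑ_ : Exp → Exp → Set
m ≤ₑ e = ∃[ n ] m ⊕ n ≡ e

_≤ₑ?_ : (m e : Exp) → Dec (m ≤ₑ e)
(a , b) ≤ₑ? (c , d) with a ≤? c | b ≤? d
... | yes a≤c | yes b≤d = yes ((c ∸ a , d ∸ b) , ×-≡,≡→≡ (ℕ.m+[n∸m]≡n a≤c , ℕ.m+[n∸m]≡n b≤d))
... | no a≰c | _       = no λ { ((n₁ , _) , refl) → a≰c (ℕ.m≤m+n a n₁) }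
... | _       | no b≰d = no λ { ((_ , n₂) , refl) → b≰d (ℕ.m≤m+n b n₂) }

⟦_⟧ : Poly → Exp → ℤ
⟦ p ⟧ (a , b) = coeff p a b

termCoeff : Term → Exp → ℤ
termCoeff (c , a' , b') (a , b) = if does (a' ≟ a) ∧ does (b' ≟ b) then c else 0ℤ

_·ₜ_ : Term → Term → Term
(c , m) ·ₜ (d , n) = c *ℤ d , m ⊕ n

termCoeff-≡ : ∀ c m → termCoeff (c , m) m ≡ c
termCoeff-≡ c (a , b) rewrite dec-true (a ≟ a) refl | dec-true (b ≟ b) refl = refl

termCoeff-≢ : ∀ c {m e} → m ≢ e → termCoeff (c , m) e ≡ 0ℤ
termCoeff-≢ c {a' , b'} {a , b} m≢e with a' ≟ a
... | no a'≢a rewrite dec-false (a' ≟ a) a'≢a = refl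
... | yes refl rewrite dec-true (a ≟ a) refl | dec-false (b' ≟ b) (m≢e ∘ cong (a ,_)) = refl

termCoeff-≢0⇒≡ : ∀ {c m e} → termCoeff (c , m) e ≢ 0ℤ → m ≡ e
termCoeff-≢0⇒≡ {c} {m} {e} t≢0 with m ≟ₑ e
... | yes m≡e = m≡e
... | no m≢e  = ⊥-elim (t≢0 (termCoeff-≢ c m≢e))

termCoeff-·ₜ : ∀ c m u e → termCoeff ((c , m) ·ₜ u) (m ⊕ e) ≡ c *ℤ termCoeff u e
termCoeff-·ₜ c m (d , n) e with n ≟ₑ e
... | yes refl = trans (termCoeff-≡ (c *ℤ d) (m ⊕ n)) (cong (c *ℤ_) (sym (termCoeff-≡ d n)))
... | no n≢e   = begin
  termCoeff (c *ℤ d , m ⊕ n) (m ⊕ e) ≡⟨ termCoeff-≢ (c *ℤ d) (n≢e ∘ ⊕-cancelˡ m) ⟩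
  0ℤ                                 ≡⟨ ℤ.*-zeroʳ c ⟨
  c *ℤ 0ℤ                            ≡⟨ cong (c *ℤ_) (termCoeff-≢ d n≢e) ⟨
  c *ℤ termCoeff (d , n) e           ∎
  where open ≡-Reasoning

coeff-++ : ∀ p q e → ⟦ p ++ q ⟧ e ≡ ⟦ p ⟧ e +ℤ ⟦ q ⟧ e
coeff-++ []      q e = sym (ℤ.+-identityˡ (⟦ q ⟧ e))
coeff-++ (t ∷ p) q e =
  trans (cong (termCoeff t e +ℤ_) (coeff-++ p q e)) (sym (ℤ.+-assoc (termCoeff t e) _ _))

coeff-map-·ₜ : ∀ c m q e → ⟦ map ((c , m) ·ₜ_) q ⟧ (m ⊕ e) ≡ c *ℤ ⟦ q ⟧ e
coeff-map-·ₜ c m []      e = sym (ℤ.*-zeroʳ c)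
coeff-map-·ₜ c m (u ∷ q) e = begin
  termCoeff ((c , m) ·ₜ u) (m ⊕ e) +ℤ ⟦ map ((c , m) ·ₜ_) q ⟧ (m ⊕ e)
    ≡⟨ cong₂ _+ℤ_ (termCoeff-·ₜ c m u e) (coeff-map-·ₜ c m q e) ⟩
  c *ℤ termCoeff u e +ℤ c *ℤ ⟦ q ⟧ e
    ≡⟨ ℤ.*-distribˡ-+ c (termCoeff u e) (⟦ q ⟧ e) ⟨
  c *ℤ (termCoeff u e +ℤ ⟦ q ⟧ e) ∎
  where open ≡-Reasoning

coeff-map-·ₜ-≰ : ∀ c m q e → ¬ m ≤ₑ e → ⟦ map ((c , m) ·ₜ_) q ⟧ e ≡ 0ℤ
coeff-map-·ₜ-≰ c m []            e m≰e = refl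
coeff-map-·ₜ-≰ c m ((d , n) ∷ q) e m≰e =
  trans (cong₂ _+ℤ_ (termCoeff-≢ (c *ℤ d) (λ m⊕n≡e → m≰e (n , m⊕n≡e))) (coeff-map-·ₜ-≰ c m q e m≰e))
        (ℤ.+-identityˡ 0ℤ)

coeff-≢0⇒∈ : ∀ p e → ⟦ p ⟧ e ≢ 0ℤ → e ∈ map proj₂ p
coeff-≢0⇒∈ []            e p≢0 = ⊥-elim (p≢0 refl)
coeff-≢0⇒∈ ((c , m) ∷ p) e p≢0 with m ≟ₑ e
... | yes refl = here refl
... | no m≢e   = there (coeff-≢0⇒∈ p e λ p≡0 → p≢0 (trans (cong₂ _+ℤ_ (termCoeff-≢ c m≢e) p≡0) refl))

sum≤ : ℕ → (ℕ → ℤ) → ℤ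
sum≤ zero    g = g zero
sum≤ (suc n) g = sum≤ n g +ℤ g (suc n)

sum≤-cong : ∀ n {g h} → (∀ i → g i ≡ h i) → sum≤ n g ≡ sum≤ n h
sum≤-cong zero    g≗h = g≗h zero
sum≤-cong (suc n) g≗h = cong₂ _+ℤ_ (sum≤-cong n g≗h) (g≗h (suc n))

sum≤-+ : ∀ n g h → sum≤ n (λ i → g i +ℤ h i) ≡ sum≤ n g +ℤ sum≤ n h
sum≤-+ zero    g h = refl
sum≤-+ (suc n) g h =
  trans (cong (_+ℤ (g (suc n) +ℤ h (suc n))) (sum≤-+ n g h))
        (ℤ-interchange (sum≤ n g) (sum≤ n h) (g (suc n)) (h (suc n)))
  where
  open import Algebra.Properties.CommutativeSemigroup ℤ.+-commutativeSemigroup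
    renaming (interchange to ℤ-interchange)

sum≤-≢0 : ∀ n g → sum≤ n g ≢ 0ℤ → ∃[ i ] i ≤ n × g i ≢ 0ℤ
sum≤-≢0 zero    g g0≢0 = zero , ℕ.≤-refl , g0≢0
sum≤-≢0 (suc n) g s≢0 with g (suc n) ℤ.≟ 0ℤ
... | no gn≢0 = suc n , ℕ.≤-refl , gn≢0
... | yes gn≡0 with sum≤-≢0 n g (λ s≡0 → s≢0 (cong₂ _+ℤ_ s≡0 gn≡0))
...   | i , i≤n , gi≢0 = i , ℕ.m≤n⇒m≤1+n i≤n , gi≢0

sum≤-zero : ∀ n g → (∀ i → i ≤ n → g i ≡ 0ℤ) → sum≤ n g ≡ 0ℤ
sum≤-zero n g g≡0 = decidable-stable (sum≤ n g ℤ.≟ 0ℤ) λ s≢0 →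
  let i , i≤n , gi≢0 = sum≤-≢0 n g s≢0 in gi≢0 (g≡0 i i≤n)

sum≤-single : ∀ n g {j} → j ≤ n → (∀ i → i ≤ n → i ≢ j → g i ≡ 0ℤ) → sum≤ n g ≡ g j
sum≤-single zero    g z≤n others = refl
sum≤-single (suc n) g {j} j≤1+n others with j ≟ suc n
... | yes refl = trans (cong (_+ℤ g (suc n)) (sum≤-zero n g below)) (ℤ.+-identityˡ (g (suc n)))
  where
  below : ∀ i → i ≤ n → g i ≡ 0ℤ
  below i i≤n = others i (ℕ.m≤n⇒m≤1+n i≤n) (ℕ.<⇒≢ (s≤s i≤n))
... | no j≢1+n = trans (cong₂ _+ℤ_ below top) (ℤ.+-identityʳ (g j))
  where
  below : sum≤ n g ≡ g j
  below = sum≤-single n g (ℕ.≤-pred (ℕ.≤∧≢⇒< j≤1+n j≢1+n)) (λ i i≤n → others i (ℕ.m≤n⇒m≤1+n i≤n))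
  top : g (suc n) ≡ 0ℤ
  top = others (suc n) ℕ.≤-refl (j≢1+n ∘ sym)

_✶_ : (Exp → ℤ) → (Exp → ℤ) → Exp → ℤ
(F ✶ H) (C , D) = sum≤ C λ a → sum≤ D λ b → F (a , b) *ℤ H (C ∸ a , D ∸ b)

*-≢0ˡ : ∀ x y → x *ℤ y ≢ 0ℤ → x ≢ 0ℤ
*-≢0ˡ x y xy≢0 refl = xy≢0 refl

*-≢0ʳ : ∀ x y → x *ℤ y ≢ 0ℤ → y ≢ 0ℤ
*-≢0ʳ x y xy≢0 refl = xy≢0 (ℤ.*-zeroʳ x)

split-∸ : ∀ {a b C D} → a ≤ C → b ≤ D → (a , b) ⊕ (C ∸ a , D ∸ b) ≡ (C , D)
split-∸ a≤C b≤D = ×-≡,≡→≡ (ℕ.m+[n∸m]≡n a≤C , ℕ.m+[n∸m]≡n b≤D)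

✶-≢0 : ∀ F H e → (F ✶ H) e ≢ 0ℤ → ∃[ e₁ ] ∃[ e₂ ] e₁ ⊕ e₂ ≡ e × F e₁ ≢ 0ℤ × H e₂ ≢ 0ℤ
✶-≢0 F H (C , D) FH≢0 =
  let a , a≤C , inner≢0 = sum≤-≢0 C _ FH≢0
      b , b≤D , term≢0  = sum≤-≢0 D _ inner≢0
      e₁ = a , b
      e₂ = C ∸ a , D ∸ b
  in e₁ , e₂ , split-∸ a≤C b≤D , *-≢0ˡ (F e₁) (H e₂) term≢0 , *-≢0ʳ (F e₁) (H e₂) term≢0

✶-zero : ∀ F H e → (∀ e₁ e₂ → e₁ ⊕ e₂ ≡ e → F e₁ ≢ 0ℤ → H e₂ ≢ 0ℤ → ⊥) → (F ✶ H) e ≡ 0ℤ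
✶-zero F H e no-split = decidable-stable ((F ✶ H) e ℤ.≟ 0ℤ) λ FH≢0 →
  let e₁ , e₂ , e₁⊕e₂≡e , Fe₁≢0 , He₂≢0 = ✶-≢0 F H e FH≢0 in no-split e₁ e₂ e₁⊕e₂≡e Fe₁≢0 He₂≢0

✶-single : ∀ F H m n → (∀ e₁ e₂ → e₁ ⊕ e₂ ≡ m ⊕ n → F e₁ ≢ 0ℤ → H e₂ ≢ 0ℤ → e₁ ≡ m) →
           (F ✶ H) (m ⊕ n) ≡ F m *ℤ H n
✶-single F H (m₁ , m₂) (n₁ , n₂) only-m = begin
  sum≤ C (λ a → sum≤ D (term a))  ≡⟨ sum≤-single C _ (ℕ.m≤m+n m₁ n₁) (λ a a≤C a≢m₁ →
                                        sum≤-zero D _ λ b b≤D → vanish a≤C b≤D (a≢m₁ ∘ cong proj₁)) ⟩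
  sum≤ D (term m₁)               ≡⟨ sum≤-single D _ (ℕ.m≤m+n m₂ n₂) (λ b b≤D b≢m₂ →
                                        vanish (ℕ.m≤m+n m₁ n₁) b≤D (b≢m₂ ∘ cong proj₂)) ⟩
  term m₁ m₂                     ≡⟨ cong₂ (λ i j → F (m₁ , m₂) *ℤ H (i , j)) (ℕ.m+n∸m≡n m₁ n₁) (ℕ.m+n∸m≡n m₂ n₂) ⟩
  F (m₁ , m₂) *ℤ H (n₁ , n₂)     ∎
  where
  open ≡-Reasoning
  C = m₁ + n₁
  D = m₂ + n₂
  h : ℕ → ℕ → ℤ
  h a b = H (C ∸ a , D ∸ b)
  term : ℕ → ℕ → ℤ
  term a b = F (a , b) *ℤ h a b
  vanish : ∀ {a b} → a ≤ C → b ≤ D → (a , b) ≢ (m₁ , m₂) → term a b ≡ 0ℤ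
  vanish {a} {b} a≤C b≤D ab≢m = decidable-stable (term a b ℤ.≟ 0ℤ) λ term≢0 →
    ab≢m (only-m _ _ (split-∸ a≤C b≤D) (*-≢0ˡ (F (a , b)) (h a b) term≢0) (*-≢0ʳ (F (a , b)) (h a b) term≢0))

✶-distribʳ-+ : ∀ F G H e → ((λ e' → F e' +ℤ G e') ✶ H) e ≡ (F ✶ H) e +ℤ (G ✶ H) e
✶-distribʳ-+ F G H (C , D) = begin
  sum≤ C (λ a → sum≤ D λ b → (F (a , b) +ℤ G (a , b)) *ℤ h a b)
    ≡⟨ sum≤-cong C (λ a → trans (sum≤-cong D λ b → ℤ.*-distribʳ-+ (h a b) (F (a , b)) (G (a , b)))
                                (sum≤-+ D _ _)) ⟩
  sum≤ C (λ a → sum≤ D (λ b → F (a , b) *ℤ h a b) +ℤ sum≤ D (λ b → G (a , b) *ℤ h a b))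
    ≡⟨ sum≤-+ C _ _ ⟩
  (F ✶ H) (C , D) +ℤ (G ✶ H) (C , D) ∎
  where
  open ≡-Reasoning
  h : ℕ → ℕ → ℤ
  h a b = H (C ∸ a , D ∸ b)

✶-termˡ : ∀ c m H n → (termCoeff (c , m) ✶ H) (m ⊕ n) ≡ c *ℤ H n
✶-termˡ c m H n =
  trans (✶-single (termCoeff (c , m)) H m n (λ _ _ _ t≢0 _ → sym (termCoeff-≢0⇒≡ t≢0)))
        (cong (_*ℤ H n) (termCoeff-≡ c m))

coeff-map-·ₜ-✶ : ∀ t q e → ⟦ map (t ·ₜ_) q ⟧ e ≡ (termCoeff t ✶ ⟦ q ⟧) e
coeff-map-·ₜ-✶ (c , m) q e with m ≤ₑ? e
... | yes (n , refl) = trans (coeff-map-·ₜ c m q n) (sym (✶-termˡ c m ⟦ q ⟧ n))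
... | no m≰e = trans (coeff-map-·ₜ-≰ c m q e m≰e) (sym (✶-zero (termCoeff (c , m)) ⟦ q ⟧ e λ e₁ e₂ e₁⊕e₂≡e t≢0 _ →
  m≰e (e₂ , subst (λ x → x ⊕ e₂ ≡ e) (sym (termCoeff-≢0⇒≡ t≢0)) e₁⊕e₂≡e)))

coeff-*P : ∀ p q e → ⟦ p *P q ⟧ e ≡ (⟦ p ⟧ ✶ ⟦ q ⟧) e
coeff-*P []      q e = sym (✶-zero ⟦ [] ⟧ ⟦ q ⟧ e λ _ _ _ 0≢0 _ → 0≢0 refl)
coeff-*P (t ∷ p) q e = begin
  ⟦ map (t ·ₜ_) q ++ p *P q ⟧ e                 ≡⟨ coeff-++ (map (t ·ₜ_) q) (p *P q) e ⟩
  ⟦ map (t ·ₜ_) q ⟧ e +ℤ ⟦ p *P q ⟧ e           ≡⟨ cong₂ _+ℤ_ (coeff-map-·ₜ-✶ t q e) (coeff-*P p q e) ⟩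
  (termCoeff t ✶ ⟦ q ⟧) e +ℤ (⟦ p ⟧ ✶ ⟦ q ⟧) e  ≡⟨ ✶-distribʳ-+ (termCoeff t) ⟦ p ⟧ ⟦ q ⟧ e ⟨
  (⟦ t ∷ p ⟧ ✶ ⟦ q ⟧) e                         ∎
  where open ≡-Reasoning

+-cancel-≤ : ∀ {m n o p} → m ≤ o → n ≤ p → m + n ≡ o + p → m ≡ o
+-cancel-≤ {m} {n} {o} {p} m≤o n≤p eq = ℕ.≤-antisym m≤o (ℕ.+-cancelʳ-≤ n o m o+n≤m+n)
  where
  open ℕ.≤-Reasoning
  o+n≤m+n : o + n ≤ m + n
  o+n≤m+n = begin
    o + n ≤⟨ ℕ.+-monoʳ-≤ o n≤p ⟩
    o + p ≡⟨ eq ⟨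
    m + n ∎

lexOrder : TotalOrder _ _ _
lexOrder = ×-totalOrder ℕ.≤-decTotalOrder ℕ.≤-totalOrder

_≤ₗₑₓ_ : ℕ × ℕ → ℕ × ℕ → Set
_≤ₗₑₓ_ = TotalOrder._≤_ lexOrder

≤ₗₑₓ-cases : ∀ {x y} → x ≤ₗₑₓ y → proj₁ x < proj₁ y ⊎ (proj₁ x ≡ proj₁ y × proj₂ x ≤ proj₂ y)
≤ₗₑₓ-cases (inj₁ (x₁≤y₁ , x₁≢y₁)) = inj₁ (ℕ.≤∧≢⇒< x₁≤y₁ x₁≢y₁)
≤ₗₑₓ-cases (inj₂ x₁≡y₁∧x₂≤y₂)     = inj₂ x₁≡y₁∧x₂≤y₂

<⇒≤ₗₑₓ : ∀ {x y} → proj₁ x < proj₁ y → x ≤ₗₑₓ y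
<⇒≤ₗₑₓ x₁<y₁ = inj₁ (ℕ.<⇒≤ x₁<y₁ , ℕ.<⇒≢ x₁<y₁)

≤ₗₑₓ⇒≤₁ : ∀ {x y} → x ≤ₗₑₓ y → proj₁ x ≤ proj₁ y
≤ₗₑₓ⇒≤₁ (inj₁ (x₁≤y₁ , _)) = x₁≤y₁
≤ₗₑₓ⇒≤₁ (inj₂ (x₁≡y₁ , _)) = ℕ.≤-reflexive x₁≡y₁

≤ₗₑₓ∧≡₁⇒≤₂ : ∀ {x y} → x ≤ₗₑₓ y → proj₁ x ≡ proj₁ y → proj₂ x ≤ proj₂ y
≤ₗₑₓ∧≡₁⇒≤₂ (inj₁ (_ , x₁≢y₁)) x₁≡y₁ = ⊥-elim (x₁≢y₁ x₁≡y₁)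
≤ₗₑₓ∧≡₁⇒≤₂ (inj₂ (_ , x₂≤y₂)) _     = x₂≤y₂

+-mono-≤ₗₑₓ : ∀ {x x' y y'} → x ≤ₗₑₓ x' → y ≤ₗₑₓ y' → (x ⊕ y) ≤ₗₑₓ (x' ⊕ y')
+-mono-≤ₗₑₓ x≤x' y≤y' with ≤ₗₑₓ-cases x≤x' | ≤ₗₑₓ-cases y≤y'
... | inj₁ x₁<x'₁          | _                    = <⇒≤ₗₑₓ (ℕ.+-mono-<-≤ x₁<x'₁ (≤ₗₑₓ⇒≤₁ y≤y'))
... | inj₂ (x₁≡x'₁ , _)    | inj₁ y₁<y'₁          = <⇒≤ₗₑₓ (ℕ.+-mono-≤-< (ℕ.≤-reflexive x₁≡x'₁) y₁<y'₁)
... | inj₂ (x₁≡x'₁ , x₂≤x'₂) | inj₂ (y₁≡y'₁ , y₂≤y'₂) =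
  inj₂ (cong₂ _+_ x₁≡x'₁ y₁≡y'₁ , ℕ.+-mono-≤ x₂≤x'₂ y₂≤y'₂)

+-cancel-≤ₗₑₓ : ∀ {x x' y y'} → x ≤ₗₑₓ x' → y ≤ₗₑₓ y' → x ⊕ y ≡ x' ⊕ y' → x ≡ x'
+-cancel-≤ₗₑₓ {x₁ , _} {x'₁ , _} {y₁ , _} {y'₁ , _} x≤x' y≤y' eq =
  ×-≡,≡→≡ (x₁≡x'₁ , +-cancel-≤ (≤ₗₑₓ∧≡₁⇒≤₂ x≤x' x₁≡x'₁) (≤ₗₑₓ∧≡₁⇒≤₂ y≤y' y₁≡y'₁) (cong proj₂ eq))
  where
  x₁≡x'₁ : x₁ ≡ x'₁
  x₁≡x'₁ = +-cancel-≤ (≤ₗₑₓ⇒≤₁ x≤x') (≤ₗₑₓ⇒≤₁ y≤y') (cong proj₁ eq)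
  y₁≡y'₁ : y₁ ≡ y'₁
  y₁≡y'₁ = ℕ.+-cancelˡ-≡ x'₁ _ _ (subst (λ z → z + y₁ ≡ x'₁ + y'₁) x₁≡x'₁ (cong proj₁ eq))

IsSingleTop : (Exp → ℤ) → Exp → Set
IsSingleTop F m = F m ≢ 0ℤ × (∀ e → F e ≢ 0ℤ → deg e < deg m ⊎ e ≡ m)

module GradedOrder (w : Exp → ℕ)
                   (w-⊕ : ∀ e e' → w (e ⊕ e') ≡ w e + w e')
                   (w-injective : ∀ {e e'} → deg e ≡ deg e' → w e ≡ w e' → e ≡ e') where

  key : Exp → ℕ × ℕ
  key e = deg e , w e

  key-⊕ : ∀ e e' → key (e ⊕ e') ≡ key e ⊕ key e'
  key-⊕ e e' = ×-≡,≡→≡ (deg-⊕ e e' , w-⊕ e e')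

  key-injective : ∀ {e e'} → key e ≡ key e' → e ≡ e'
  key-injective eq = w-injective (cong proj₁ eq) (cong proj₂ eq)

  _≼_ : Exp → Exp → Set
  e ≼ e' = key e ≤ₗₑₓ key e'

  Leading : (Exp → ℤ) → Exp → Set
  Leading F m = F m ≢ 0ℤ × (∀ e → F e ≢ 0ℤ → e ≼ m)

  leading-cong : ∀ {F G m} → (∀ e → F e ≡ G e) → Leading F m → Leading G m
  leading-cong F≗G (Fm≢0 , m-max) =
    (λ Gm≡0 → Fm≢0 (trans (F≗G _) Gm≡0)) , λ e Ge≢0 → m-max e (λ Fe≡0 → Ge≢0 (trans (sym (F≗G e)) Fe≡0))

  leading-unique : ∀ {F m m'} → Leading F m → Leading F m' → m ≡ m'
  leading-unique (Fm≢0 , m-max) (Fm'≢0 , m'-max) =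
    key-injective (≡×≡⇒≡ (TotalOrder.antisym lexOrder (m'-max _ Fm≢0) (m-max _ Fm'≢0)))

  leading-exists : ∀ p {e₀} → ⟦ p ⟧ e₀ ≢ 0ℤ → ∃ (Leading ⟦ p ⟧)
  leading-exists p {e₀} pe₀≢0 =
    argmax key e₀ support ,
    argmax-all key pe₀≢0 (all-filter nonzero? (map proj₂ p)) ,
    λ e pe≢0 → lookup (f[xs]≤f[argmax] e₀ support) (∈-filter⁺ nonzero? (coeff-≢0⇒∈ p e pe≢0) pe≢0)
    where
    open import Data.List.Extrema lexOrder using (argmax; argmax-all; f[xs]≤f[argmax])
    nonzero? : ∀ e → Dec (⟦ p ⟧ e ≢ 0ℤ)
    nonzero? e = ¬? (⟦ p ⟧ e ℤ.≟ 0ℤ)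
    support : List Exp
    support = filter nonzero? (map proj₂ p)

  leading-⊕-cancel : ∀ {F H m n e₁ e₂} → Leading F m → Leading H n →
                     F e₁ ≢ 0ℤ → H e₂ ≢ 0ℤ → e₁ ⊕ e₂ ≡ m ⊕ n → e₁ ≡ m
  leading-⊕-cancel {e₁ = e₁} {e₂} (_ , m-max) (_ , n-max) Fe₁≢0 He₂≢0 eq =
    key-injective (+-cancel-≤ₗₑₓ (m-max e₁ Fe₁≢0) (n-max e₂ He₂≢0)
                                 (trans (sym (key-⊕ e₁ e₂)) (trans (cong key eq) (key-⊕ _ _))))

  leading-✶ : ∀ {F H m n} → Leading F m → Leading H n → Leading (F ✶ H) (m ⊕ n)
  leading-✶ {F} {H} {m} {n} LF@(Fm≢0 , m-max) LH@(Hn≢0 , n-max) = top≢0 , top-max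
    where
    top : (F ✶ H) (m ⊕ n) ≡ F m *ℤ H n
    top = ✶-single F H m n λ _ _ eq Fe₁≢0 He₂≢0 → leading-⊕-cancel LF LH Fe₁≢0 He₂≢0 eq
    top≢0 : (F ✶ H) (m ⊕ n) ≢ 0ℤ
    top≢0 FH≡0 = [ Fm≢0 , Hn≢0 ] (ℤ.i*j≡0⇒i≡0∨j≡0 (F m) (trans (sym top) FH≡0))
    top-max : ∀ e → (F ✶ H) e ≢ 0ℤ → e ≼ (m ⊕ n)
    top-max e FH≢0 with ✶-≢0 F H e FH≢0
    ... | e₁ , e₂ , refl , Fe₁≢0 , He₂≢0 =
      subst₂ _≤ₗₑₓ_ (sym (key-⊕ e₁ e₂)) (sym (key-⊕ m n)) (+-mono-≤ₗₑₓ (m-max e₁ Fe₁≢0) (n-max e₂ He₂≢0))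

  singleTop⇒leading : ∀ {F m} → IsSingleTop F m → Leading F m
  singleTop⇒leading (Fm≢0 , m-top) =
    Fm≢0 , λ e Fe≢0 → [ <⇒≤ₗₑₓ , (λ { refl → TotalOrder.refl lexOrder }) ] (m-top e Fe≢0)

  leading-⊕≡top : ∀ {F H G m n T} → Leading F m → Leading H n →
                         (∀ e → (F ✶ H) e ≡ G e) → IsSingleTop G T → m ⊕ n ≡ T
  leading-⊕≡top LF LH FH≗G G-top =
    leading-unique (leading-cong FH≗G (leading-✶ LF LH)) (singleTop⇒leading G-top)

deg∧proj₁-injective : ∀ {e e'} → deg e ≡ deg e' → proj₁ e ≡ proj₁ e' → e ≡ e'
deg∧proj₁-injective {a , b} {_ , b'} deg≡ refl = cong (a ,_) (ℕ.+-cancelˡ-≡ a b b' deg≡)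

deg∧proj₂-injective : ∀ {e e'} → deg e ≡ deg e' → proj₂ e ≡ proj₂ e' → e ≡ e'
deg∧proj₂-injective {a , b} {a' , _} deg≡ refl = cong (_, b) (ℕ.+-cancelʳ-≡ b a a' deg≡)

module ByX = GradedOrder proj₁ (λ _ _ → refl) deg∧proj₁-injective
module ByY = GradedOrder proj₂ (λ _ _ → refl) deg∧proj₂-injective

leading-in-both⇒singleTop : ∀ {F m} → ByX.Leading F m → ByY.Leading F m → IsSingleTop F m
leading-in-both⇒singleTop {F} {m} (Fm≢0 , x-max) (_ , y-max) = Fm≢0 , m-top
  where
  m-top : ∀ e → F e ≢ 0ℤ → deg e < deg m ⊎ e ≡ m
  m-top e Fe≢0 with ≤ₗₑₓ-cases (x-max e Fe≢0) | ≤ₗₑₓ-cases (y-max e Fe≢0)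
  ... | inj₁ deg< | _ = inj₁ deg<
  ... | inj₂ (deg≡ , _) | inj₁ deg< = ⊥-elim (ℕ.<-irrefl deg≡ deg<)
  ... | inj₂ (deg≡ , e₁≤m₁) | inj₂ (_ , e₂≤m₂) = inj₂ (deg∧proj₁-injective deg≡ (+-cancel-≤ e₁≤m₁ e₂≤m₂ deg≡))

factor-singleTop : ∀ f h g {T} → (f *P h) ≈P g → IsSingleTop ⟦ g ⟧ T → ∃ (IsSingleTop ⟦ f ⟧)
factor-singleTop f h g {T} fh≈g g-top@(gT≢0 , _)
  with ✶-≢0 ⟦ f ⟧ ⟦ h ⟧ T (λ fhT≡0 → gT≢0 (trans (sym (fh≈g _ _)) (trans (coeff-*P f h T) fhT≡0)))
... | e₁ , e₂ , _ , fe₁≢0 , he₂≢0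
  with ByX.leading-exists f fe₁≢0 | ByX.leading-exists h he₂≢0
     | ByY.leading-exists f fe₁≢0 | ByY.leading-exists h he₂≢0
... | p , x-f | r , x-h | q , y-f | t , y-h =
  p , leading-in-both⇒singleTop x-f (subst (ByY.Leading ⟦ f ⟧) q≡p y-f)
  where
  fh≗g : ∀ e → (⟦ f ⟧ ✶ ⟦ h ⟧) e ≡ ⟦ g ⟧ e
  fh≗g e = trans (sym (coeff-*P f h e)) (fh≈g (proj₁ e) (proj₂ e))
  q≡p : q ≡ p
  q≡p = ByX.leading-⊕-cancel x-f x-h (proj₁ y-f) (proj₁ y-h)
          (trans (ByY.leading-⊕≡top y-f y-h fh≗g g-top) (sym (ByX.leading-⊕≡top x-f x-h fh≗g g-top)))

singleTop-cons : ∀ c m p {T} → deg m < deg T → IsSingleTop ⟦ p ⟧ T → IsSingleTop ⟦ (c , m) ∷ p ⟧ T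
singleTop-cons c m p {T} m<T (pT≢0 , T-top) = (λ eq → pT≢0 (trans (sym (skip m≢T)) eq)) , T-top'
  where
  skip : ∀ {e} → m ≢ e → ⟦ (c , m) ∷ p ⟧ e ≡ ⟦ p ⟧ e
  skip m≢e = trans (cong (_+ℤ _) (termCoeff-≢ c m≢e)) (ℤ.+-identityˡ _)
  m≢T : m ≢ T
  m≢T refl = ℕ.<-irrefl refl m<T
  T-top' : ∀ e → ⟦ (c , m) ∷ p ⟧ e ≢ 0ℤ → deg e < deg T ⊎ e ≡ T
  T-top' e ≢0 with m ≟ₑ e
  ... | yes refl = inj₁ m<T
  ... | no m≢e = T-top e (λ eq → ≢0 (trans (skip m≢e) eq))

singleTop-term : ∀ {c} m → c ≢ 0ℤ → IsSingleTop ⟦ (c , m) ∷ [] ⟧ m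
singleTop-term {c} m c≢0 =
  (λ eq → c≢0 (trans (sym coeff-m) eq)) ,
  λ e ≢0 → inj₂ (sym (termCoeff-≢0⇒≡ (λ eq → ≢0 (trans (ℤ.+-identityʳ _) eq))))
  where
  coeff-m : ⟦ (c , m) ∷ [] ⟧ m ≡ c
  coeff-m = trans (ℤ.+-identityʳ _) (termCoeff-≡ c m)

genTop : ℕ → ℕ → List Bool → Exp
genTop a b []          = a , b
genTop a b (false ∷ s) = genTop (suc a) b s
genTop a b (true ∷ s)  = genTop a (suc b) s

deg-<-genTop : ∀ a b x s → a + b < deg (genTop a b (x ∷ s))
deg-genTop : ∀ a b s → a + b ≤ deg (genTop a b s)

deg-genTop a b []      = ℕ.≤-refl
deg-genTop a b (x ∷ s) = ℕ.<⇒≤ (deg-<-genTop a b x s)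

deg-<-genTop a b false s = deg-genTop (suc a) b s
deg-<-genTop a b true  s = subst (_≤ deg (genTop a (suc b) s)) (ℕ.+-suc a b) (deg-genTop a (suc b) s)

genAux-singleTop : ∀ a b s → IsSingleTop ⟦ genAux a b s ⟧ (genTop a b s)
genAux-singleTop a b []          = singleTop-term (a , b) (λ ())
genAux-singleTop a b (false ∷ s) =
  singleTop-cons 1ℤ (a , b) (genAux (suc a) b s) (deg-<-genTop a b false s) (genAux-singleTop (suc a) b s)
genAux-singleTop a b (true ∷ s)  =
  singleTop-cons 1ℤ (a , b) (genAux a (suc b) s) (deg-<-genTop a b true s) (genAux-singleTop a (suc b) s)

singleTop⇒SingleTopMonomial : ∀ {p m} → IsSingleTop ⟦ p ⟧ m → SingleTopMonomial p
singleTop⇒SingleTopMonomial {m = a , b} (pm≢0 , m-top) =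
  a , b , pm≢0 , λ c d pcd≢0 → Sum.map₂ ×-≡,≡←≡ (m-top (c , d) pcd≢0)

lemma9 : ∀ (P f : Poly) → IsGenerating P → f ∣P P → SingleTopMonomial f
lemma9 P f (s , P≈gen) (h , fh≈P) =
  singleTop⇒SingleTopMonomial {f} (proj₂ (factor-singleTop f h (genPoly s) fh≈gen (genAux-singleTop 0 0 s)))
  where
  fh≈gen : (f *P h) ≈P genPoly s
  fh≈gen a b = trans (fh≈P a b) (P≈gen a b)
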